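{- If $n$ and $r$ are integers with $3 \le n \leq r$, then ${\rm sg}(P_r\,\square\, C_n)\leq \lceil 2\sqrt{n}\, \rceil$.
   Context: $P_m$ denotes the path with vertex set $\{1,\dots,m\}$ and edges $\{i,i+1\}$; $C_n$ ($n\ge 3$) denotes the cycle with vertex set $\{1,\dots,n\}$ and edges $\{i,i+1\}$ and $\{n,1\}$. The Cartesian product $G\,\square\, H$ has vertex set $V(G)\times V(H)$, with $(g,h)$ adjacent to $(g',h')$ iff either $g=g'$ and $hh'\in E(H)$, or $h=h'$ and $gg'\in E(G)$. For a graph $G=(V,E)$ and $S\subseteq V$, for each pair $\{x,y\}\subseteq S$ with $x\neq y$ let $\widetilde{P}(x,y)$ be a selected fixed shortest $x,y$-path, and let $\widetilde{I}(S)=\{\widetilde{P}(x,y): x,y\in S\}$. $S$ is a strong geodetic set if for some such choice of geodesics, every vertex of $G$ lies on some path of $\widetilde{I}(S)$. The strong geodetic number ${\rm sg}(G)$ is the minimum cardinality of a strong geodetic set of $G$. -}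

module Defs where

open import Data.Nat using (ℕ; zero; suc; _+_; _*_; _≤_; _<_)
open import Data.Fin using (Fin; toℕ)
open import Data.Product using (Σ; _×_; _,_; ∃)
open import Data.Sum using (_⊎_)
open import Relation.Binary.PropositionalEquality using (_≡_)
open import Function.Definitions using (Injective)

module _ {V : Set} (E : V → V → Set) where

  data Walk : V → V → Set where
    []  : ∀ {x} → Walk x x
    _∷_ : ∀ {x y z} → E x y → Walk y z → Walk x z

  len : ∀ {x y} → Walk x y → ℕ
  len []      = 0
  len (_ ∷ w) = suc (len w)

  data OnWalk (v : V) : ∀ {x y} → Walk x y → Set where
    here  : ∀ {y} {w : Walk v y} → OnWalk v w
    there : ∀ {x y z} {e : E x y} {w : Walk y z} → OnWalk v w → OnWalk v (e ∷ w)

  IsGeodesic : ∀ {x y} → Walk x y → Set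
  IsGeodesic {x} {y} w = (w' : Walk x y) → len w ≤ len w'

  -- S = {S 0, …, S (m-1)} (distinct vertices, |S| = m) is a strong geodetic
  -- set: for each unordered pair {S i, S j} (i < j) one geodesic is fixed,
  -- and every vertex lies on one of the fixed geodesics.
  IsStrongGeodetic : (m : ℕ) → (Fin m → V) → Set
  IsStrongGeodetic m S =
    Injective _≡_ _≡_ S ×
    Σ ((i j : Fin m) → toℕ i < toℕ j → Walk (S i) (S j)) λ P →
      ((i j : Fin m) (h : toℕ i < toℕ j) → IsGeodesic (P i j h)) ×
      ((v : V) → Σ (Fin m) λ i → Σ (Fin m) λ j → Σ (toℕ i < toℕ j) λ h →
                   OnWalk v (P i j h))

  SgAtMost : ℕ → Set
  SgAtMost k = Σ ℕ λ m → Σ (Fin m → V) λ S → m ≤ k × IsStrongGeodetic m S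

-- Paths, cycles, Cartesian product (vertices 1..m encoded as Fin m, i ↦ toℕ i + 1)

AdjP : (m : ℕ) → Fin m → Fin m → Set
AdjP m a b = suc (toℕ a) ≡ toℕ b ⊎ suc (toℕ b) ≡ toℕ a

AdjC : (n : ℕ) → Fin n → Fin n → Set
AdjC n a b = AdjP n a b ⊎ (toℕ a ≡ 0 × suc (toℕ b) ≡ n)
                        ⊎ (toℕ b ≡ 0 × suc (toℕ a) ≡ n)

Box : {A B : Set} → (A → A → Set) → (B → B → Set) → A × B → A × B → Set
Box EG EH (g , h) (g' , h') = (g ≡ g' × EH h h') ⊎ (h ≡ h' × EG g g')

PC : (r n : ℕ) → Fin r × Fin n → Fin r × Fin n → Set
PC r n = Box (AdjP r) (AdjC n)

IsCeil2Sqrt : ℕ → ℕ → Set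
IsCeil2Sqrt n k = (4 * n ≤ k * k) × ((j : ℕ) → j < k → j * j < 4 * n)

module Submission where

open import Defs
open import Data.Nat using (ℕ; zero; suc; _≟_; _+_; _*_; _∸_; _≤_; _<_; s≤s⁻¹; _⊓_; ∣_-_∣; z≤n; s≤s; _≤?_; _<?_; ⌊_/2⌋; ⌈_/2⌉; _/_; _%_; NonZero; >-nonZero)
open import Data.Nat.Properties
open import Data.Nat.DivMod using (%-distribˡ-+; m%n%n≡m%n; [m+n]%n≡m%n; m<n⇒m%n≡m; m%n<n; m≡m%n+[m/n]*n; m/n*n≤m; /-monoˡ-≤; m<n*o⇒m/o<n)
open import Data.Fin using (Fin; toℕ; fromℕ<; fromℕ; splitAt; join; _↑ˡ_; _↑ʳ_) renaming (zero to fzero)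
open import Data.Fin.Properties using (toℕ-injective; toℕ-fromℕ<; toℕ<n; toℕ-fromℕ; fromℕ<-toℕ; toℕ-↑ˡ; toℕ-↑ʳ; splitAt-↑ˡ; splitAt-↑ʳ; join-splitAt)
open import Data.Product using (Σ; ∃-syntax; _×_; _,_; proj₁; proj₂)
open import Data.Sum using (_⊎_; inj₁; inj₂)
open import Data.Empty using (⊥-elim)
open import Function.Definitions using (Injective)
open import Relation.Nullary using (yes; no; ¬_)
open import Relation.Binary.Definitions using (tri<; tri≈; tri>)
open import Relation.Binary.PropositionalEquality
open import Data.Nat.Solver using (module +-*-Solver)

-- Put q = ⌈k/2⌉ vertices on the bottom row of P_r □ C_n, in columns 0, …, q − 1, and one vertex
-- on the top row for each block u of columns uq, …, uq + q − 1; there are ⌈n/q⌉ ≤ ⌊k/2⌋ blocks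
-- because n ≤ ⌊k/2⌋⌈k/2⌉. A shortest path from a bottom vertex t to a top vertex a may run along
-- the bottom row to any column z on a shortest t–a arc of C_n, climb column z and finish along
-- the top row, so it covers column z. It remains to place the top vertex a of each block so
-- that its q columns can be matched with the q bottom vertices, each column on a shortest arc
-- from its partner to a. Let the s = min(q, a − ⌊n/2⌋) bottom vertices 0, …, s − 1 reach a the
-- long way round C_n, through column 0, and serve the last s columns of the block, which lie
-- beyond a; the other bottom vertices reach a directly and serve the first q − s columns, which
-- lie before a. This works when a + s ∈ {uq + q − 1, uq + q}, and such an a exists because
-- a ↦ a + s increases by 1 or 2 at each step. That the walks are shortest paths follows by
-- comparing them with the 1-Lipschitz function |ℓ − ℓ′| + d_{C_n}(x, y).

∣m-suc[m]∣≡1 : ∀ m → ∣ m - suc m ∣ ≡ 1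
∣m-suc[m]∣≡1 zero    = refl
∣m-suc[m]∣≡1 (suc m) = ∣m-suc[m]∣≡1 m

∣-∣-step : ∀ {a b} c → suc a ≡ b ⊎ suc b ≡ a → ∣ a - c ∣ ≤ suc ∣ b - c ∣
∣-∣-step {a} {b} c adj = ≤-trans (∣-∣-triangle a b c) (+-monoˡ-≤ ∣ b - c ∣ (≤-reflexive (∣a-b∣≡1 adj)))
  where
  ∣a-b∣≡1 : suc a ≡ b ⊎ suc b ≡ a → ∣ a - b ∣ ≡ 1
  ∣a-b∣≡1 (inj₁ refl) = ∣m-suc[m]∣≡1 a
  ∣a-b∣≡1 (inj₂ refl) = trans (∣-∣-comm (suc b) b) (∣m-suc[m]∣≡1 b)

suc[m]∸n≤suc[m∸n] : ∀ m n → suc m ∸ n ≤ suc (m ∸ n)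
suc[m]∸n≤suc[m∸n] m       zero    = ≤-refl
suc[m]∸n≤suc[m∸n] zero    (suc n) = ≤-trans (≤-reflexive (0∸n≡0 n)) z≤n
suc[m]∸n≤suc[m∸n] (suc m) (suc n) = suc[m]∸n≤suc[m∸n] m n

∸-telescope : ∀ {t c a} → t ≤ c → c ≤ a → (c ∸ t) + (a ∸ c) ≡ a ∸ t
∸-telescope {t} t≤c c≤a with i , refl ← m≤n⇒∃[o]m+o≡n t≤c | j , refl ← m≤n⇒∃[o]m+o≡n c≤a =
  begin
    (t + i ∸ t) + (t + i + j ∸ (t + i)) ≡⟨ cong₂ _+_ (m+n∸m≡n t i) (m+n∸m≡n (t + i) j) ⟩
    i + j                               ≡⟨ m+n∸m≡n t (i + j) ⟨
    t + (i + j) ∸ t                     ≡⟨ cong (_∸ t) (+-assoc t i j) ⟨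
    t + i + j ∸ t                       ∎
  where open ≡-Reasoning

m+[o∸n]≡o∸[n∸m] : ∀ {m n o} → m ≤ n → n ≤ o → m + (o ∸ n) ≡ o ∸ (n ∸ m)
m+[o∸n]≡o∸[n∸m] {m} {n} {o} m≤n n≤o = +-cancelʳ-≡ (n ∸ m) _ _ (begin
  m + (o ∸ n) + (n ∸ m)   ≡⟨ cong (_+ (n ∸ m)) (+-comm m (o ∸ n)) ⟩
  o ∸ n + m + (n ∸ m)     ≡⟨ +-assoc (o ∸ n) m (n ∸ m) ⟩
  o ∸ n + (m + (n ∸ m))   ≡⟨ cong (o ∸ n +_) (m+[n∸m]≡n m≤n) ⟩
  o ∸ n + n               ≡⟨ m∸n+n≡m n≤o ⟩
  o                       ≡⟨ m∸n+n≡m (≤-trans (m∸n≤m n m) n≤o) ⟨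
  o ∸ (n ∸ m) + (n ∸ m)   ∎)
  where open ≡-Reasoning

m+n+o≡n+[m+o] : ∀ m n o → m + n + o ≡ n + (m + o)
m+n+o≡n+[m+o] m n o = trans (cong (_+ o) (+-comm m n)) (+-assoc n m o)

[[m+s]%q+[q∸s]]%q≡m : ∀ {m s} q .{{_ : NonZero q}} → m < q → s ≤ q → ((m + s) % q + (q ∸ s)) % q ≡ m
[[m+s]%q+[q∸s]]%q≡m {m} {s} q m<q s≤q = begin
  ((m + s) % q + (q ∸ s)) % q         ≡⟨ %-distribˡ-+ ((m + s) % q) (q ∸ s) q ⟩
  ((m + s) % q % q + (q ∸ s) % q) % q ≡⟨ cong (λ i → (i + (q ∸ s) % q) % q) (m%n%n≡m%n (m + s) q) ⟩
  ((m + s) % q + (q ∸ s) % q) % q     ≡⟨ %-distribˡ-+ (m + s) (q ∸ s) q ⟨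
  (m + s + (q ∸ s)) % q               ≡⟨ cong (_% q) (trans (+-assoc m s (q ∸ s)) (cong (m +_) (m+[n∸m]≡n s≤q))) ⟩
  (m + q) % q                         ≡⟨ [m+n]%n≡m%n m q ⟩
  m % q                               ≡⟨ m<n⇒m%n≡m m<q ⟩
  m                                   ∎
  where open ≡-Reasoning

⌈n/2⌉≤1+⌊n/2⌋ : ∀ n → ⌈ n /2⌉ ≤ suc ⌊ n /2⌋
⌈n/2⌉≤1+⌊n/2⌋ zero          = z≤n
⌈n/2⌉≤1+⌊n/2⌋ (suc zero)    = ≤-refl
⌈n/2⌉≤1+⌊n/2⌋ (suc (suc n)) = s≤s (⌈n/2⌉≤1+⌊n/2⌋ n)

⌊n/2⌋+⌊n/2⌋≤n : ∀ n → ⌊ n /2⌋ + ⌊ n /2⌋ ≤ n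
⌊n/2⌋+⌊n/2⌋≤n n = ≤-trans (+-monoʳ-≤ ⌊ n /2⌋ (⌊n/2⌋≤⌈n/2⌉ n)) (≤-reflexive (⌊n/2⌋+⌈n/2⌉≡n n))

n≤1+⌊n/2⌋+⌊n/2⌋ : ∀ n → n ≤ suc (⌊ n /2⌋ + ⌊ n /2⌋)
n≤1+⌊n/2⌋+⌊n/2⌋ n = begin
  n                        ≡⟨ ⌊n/2⌋+⌈n/2⌉≡n n ⟨
  ⌊ n /2⌋ + ⌈ n /2⌉        ≤⟨ +-monoʳ-≤ ⌊ n /2⌋ (⌈n/2⌉≤1+⌊n/2⌋ n) ⟩
  ⌊ n /2⌋ + suc ⌊ n /2⌋    ≡⟨ +-suc ⌊ n /2⌋ ⌊ n /2⌋ ⟩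
  suc (⌊ n /2⌋ + ⌊ n /2⌋)  ∎
  where open ≤-Reasoning

module _ {V : Set} {E : V → V → Set} where

  _++_ : ∀ {x y z} → Walk E x y → Walk E y z → Walk E x z
  []      ++ w′ = w′
  (e ∷ w) ++ w′ = e ∷ (w ++ w′)

  len-++ : ∀ {x y z} (w : Walk E x y) (w′ : Walk E y z) →
           len E (w ++ w′) ≡ len E w + len E w′
  len-++ []      w′ = refl
  len-++ (e ∷ w) w′ = cong suc (len-++ w w′)

  onWalk-++ˡ : ∀ {v x y z} (w : Walk E x y) {w′ : Walk E y z} →
               OnWalk E v w → OnWalk E v (w ++ w′)
  onWalk-++ˡ _       here      = here
  onWalk-++ˡ (e ∷ w) (there o) = there (onWalk-++ˡ w o)

  onWalk-++ʳ : ∀ {v x y z} (w : Walk E x y) {w′ : Walk E y z} →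
               OnWalk E v w′ → OnWalk E v (w ++ w′)
  onWalk-++ʳ []      o = o
  onWalk-++ʳ (e ∷ w) o = there (onWalk-++ʳ w o)

  reverse : (∀ {x y} → E x y → E y x) → ∀ {x y} → Walk E x y → Walk E y x
  reverse sym-E []      = []
  reverse sym-E (e ∷ w) = reverse sym-E w ++ (sym-E e ∷ [])

  len-reverse : (sym-E : ∀ {x y} → E x y → E y x) → ∀ {x y} (w : Walk E x y) →
                len E (reverse sym-E w) ≡ len E w
  len-reverse sym-E []      = refl
  len-reverse sym-E (e ∷ w) =
    trans (len-++ (reverse sym-E w) _) (trans (cong (_+ 1) (len-reverse sym-E w)) (+-comm _ 1))

module _ {A B : Set} {E : A → A → Set} {F : B → B → Set}
         (f : A → B) (f-edge : ∀ {a b} → E a b → F (f a) (f b)) where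

  mapWalk : ∀ {x y} → Walk E x y → Walk F (f x) (f y)
  mapWalk []      = []
  mapWalk (e ∷ w) = f-edge e ∷ mapWalk w

  len-mapWalk : ∀ {x y} (w : Walk E x y) → len F (mapWalk w) ≡ len E w
  len-mapWalk []      = refl
  len-mapWalk (e ∷ w) = cong suc (len-mapWalk w)

  onWalk-mapWalk : ∀ {v x y} {w : Walk E x y} → OnWalk E v w → OnWalk F (f v) (mapWalk w)
  onWalk-mapWalk here      = here
  onWalk-mapWalk (there o) = there (onWalk-mapWalk o)

Lipschitz : {V : Set} → (V → V → Set) → (V → V → ℕ) → Set
Lipschitz E d = ∀ {u u′} v → E u u′ → d u v ≤ suc (d u′ v)

module _ {V : Set} {E : V → V → Set} {d : V → V → ℕ}
         (d-refl : ∀ v → d v v ≡ 0) (d-lip : Lipschitz E d) where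

  lipschitz⇒≤len : ∀ {u v} (w : Walk E u v) → d u v ≤ len E w
  lipschitz⇒≤len {u} []        = ≤-reflexive (d-refl u)
  lipschitz⇒≤len {v = v} (e ∷ w) = ≤-trans (d-lip v e) (s≤s (lipschitz⇒≤len w))

  len≤lipschitz⇒geodesic : ∀ {u v} (w : Walk E u v) → len E w ≤ d u v → IsGeodesic E w
  len≤lipschitz⇒geodesic w short w′ = ≤-trans short (lipschitz⇒≤len w′)

productDist : {A B : Set} → (A → A → ℕ) → (B → B → ℕ) → A × B → A × B → ℕ
productDist dA dB (a , b) (a′ , b′) = dA a a′ + dB b b′

Box-lipschitz : {A B : Set} {EA : A → A → Set} {EB : B → B → Set}
                {dA : A → A → ℕ} {dB : B → B → ℕ} → Lipschitz EA dA → Lipschitz EB dB →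
                Lipschitz (Box EA EB) (productDist dA dB)
Box-lipschitz {dA = dA} lipA lipB {a , b} (a₂ , b₂) (inj₁ (refl , e)) =
  ≤-trans (+-monoʳ-≤ (dA a a₂) (lipB b₂ e)) (≤-reflexive (+-suc _ _))
Box-lipschitz {dB = dB} lipA lipB {a , b} (a₂ , b₂) (inj₂ (refl , e)) =
  +-monoˡ-≤ (dB b b₂) (lipA a₂ e)

-- Paths and cycles

module _ {m : ℕ} where

  AdjP-sym : ∀ {a b} → AdjP m a b → AdjP m b a
  AdjP-sym (inj₁ e) = inj₂ e
  AdjP-sym (inj₂ e) = inj₁ e

  AdjP-lipschitz : Lipschitz (AdjP m) (λ a b → ∣ toℕ a - toℕ b ∣)
  AdjP-lipschitz c = ∣-∣-step (toℕ c)

  ascent : ∀ d (x y : Fin m) → toℕ x + d ≡ toℕ y → Walk (AdjP m) x y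
  ascent zero x y x+0≡y with refl ← toℕ-injective (trans (sym (+-identityʳ (toℕ x))) x+0≡y) = []
  ascent (suc d) x y x+d+1≡y = inj₁ (sym (toℕ-fromℕ< x+1<m)) ∷ ascent d (fromℕ< x+1<m) y next≡y
    where
    x+1+d≡y : suc (toℕ x) + d ≡ toℕ y
    x+1+d≡y = trans (sym (+-suc (toℕ x) d)) x+d+1≡y
    x+1<m : suc (toℕ x) < m
    x+1<m = ≤-<-trans (subst (suc (toℕ x) ≤_) x+1+d≡y (m≤m+n _ d)) (toℕ<n y)
    next≡y : toℕ (fromℕ< x+1<m) + d ≡ toℕ y
    next≡y = trans (cong (_+ d) (toℕ-fromℕ< x+1<m)) x+1+d≡y

  len-ascent : ∀ d x y eq → len (AdjP m) (ascent d x y eq) ≡ d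
  len-ascent zero x y x+0≡y with refl ← toℕ-injective (trans (sym (+-identityʳ (toℕ x))) x+0≡y) = refl
  len-ascent (suc d) x y eq = cong suc (len-ascent d _ y _)

  onWalk-ascent : ∀ d x y eq {v} → toℕ x ≤ toℕ v → toℕ v ≤ toℕ y →
                  OnWalk (AdjP m) v (ascent d x y eq)
  onWalk-ascent zero x y x+0≡y x≤v v≤y
    with refl ← toℕ-injective (trans (sym (+-identityʳ (toℕ x))) x+0≡y)
    with refl ← toℕ-injective (≤-antisym v≤y x≤v) = here
  onWalk-ascent (suc d) x y eq {v} x≤v v≤y with toℕ x ≟ toℕ v
  ... | yes x≡v with refl ← toℕ-injective x≡v = here
  ... | no  x≢v = there (onWalk-ascent d _ y _ (subst (_≤ toℕ v) (sym (toℕ-fromℕ< _)) (≤∧≢⇒< x≤v x≢v)) v≤y)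

  straight : (x y : Fin m) → Walk (AdjP m) x y
  straight x y with toℕ x ≤? toℕ y
  ... | yes x≤y = ascent (toℕ y ∸ toℕ x) x y (m+[n∸m]≡n x≤y)
  ... | no  x≰y = reverse AdjP-sym (ascent (toℕ x ∸ toℕ y) y x (m+[n∸m]≡n (<⇒≤ (≰⇒> x≰y))))

  len-straight : ∀ x y → len (AdjP m) (straight x y) ≡ ∣ toℕ x - toℕ y ∣
  len-straight x y with toℕ x ≤? toℕ y
  ... | yes x≤y = trans (len-ascent _ x y _) (sym (m≤n⇒∣m-n∣≡n∸m x≤y))
  ... | no  x≰y = trans (len-reverse AdjP-sym _)
                    (trans (len-ascent _ y x _) (sym (m≤n⇒∣n-m∣≡n∸m (<⇒≤ (≰⇒> x≰y)))))

  onWalk-straight : ∀ x y {v} → toℕ x ≤ toℕ v → toℕ v ≤ toℕ y → OnWalk (AdjP m) v (straight x y)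
  onWalk-straight x y x≤v v≤y with toℕ x ≤? toℕ y
  ... | yes x≤y = onWalk-ascent (toℕ y ∸ toℕ x) x y (m+[n∸m]≡n x≤y) x≤v v≤y
  ... | no  x≰y = ⊥-elim (x≰y (≤-trans x≤v v≤y))

minArc : ℕ → ℕ → ℕ
minArc n d = d ⊓ (n ∸ d)

cycDist : ℕ → ℕ → ℕ → ℕ
cycDist n a b = minArc n ∣ a - b ∣

Between : ℕ → ℕ → ℕ → ℕ → Set
Between n x z y = cycDist n x z + cycDist n z y ≤ cycDist n x y

minArc-lipschitz : ∀ n {d d′} → d ≤ suc d′ → d′ ≤ suc d → minArc n d ≤ suc (minArc n d′)
minArc-lipschitz n {d} {d′} d≤1+d′ d′≤1+d =
  ⊓-mono-≤ d≤1+d′ (≤-trans (∸-monoʳ-≤ (suc n) d′≤1+d) (suc[m]∸n≤suc[m∸n] n d′))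

minArc-reflect : ∀ n {d} → d ≤ n → minArc n (n ∸ d) ≡ minArc n d
minArc-reflect n {d} d≤n = trans (cong ((n ∸ d) ⊓_) (m∸[m∸n]≡n d≤n)) (⊓-comm (n ∸ d) d)

minArc-long : ∀ n {d} → ¬ d ≤ n ∸ d → minArc n d ≡ n ∸ d
minArc-long n d≰n∸d = m≥n⇒m⊓n≡n (<⇒≤ (≰⇒> d≰n∸d))

cycDist-from-last : ∀ {n b} c → suc b ≡ n → c < n → cycDist n b c ≡ minArc n (suc c)
cycDist-from-last {n} {b} c refl (s≤s c≤b) =
  trans (cong (minArc n) (m≤n⇒∣n-m∣≡n∸m c≤b)) (minArc-reflect n (s≤s c≤b))

AdjC-sym : ∀ {n a b} → AdjC n a b → AdjC n b a
AdjC-sym (inj₁ e)        = inj₁ (AdjP-sym e)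
AdjC-sym (inj₂ (inj₁ w)) = inj₂ (inj₂ w)
AdjC-sym (inj₂ (inj₂ w)) = inj₂ (inj₁ w)

cycDist-lipschitz : ∀ n → Lipschitz (AdjC n) (λ a b → cycDist n (toℕ a) (toℕ b))
cycDist-lipschitz n c (inj₁ e) =
  minArc-lipschitz n (∣-∣-step (toℕ c) e) (∣-∣-step (toℕ c) (AdjP-sym e))
cycDist-lipschitz n {a} {b} c (inj₂ (inj₁ (a≡0 , b+1≡n))) = begin
  cycDist n (toℕ a) (toℕ c)     ≡⟨ cong (λ i → minArc n ∣ i - toℕ c ∣) a≡0 ⟩
  minArc n (toℕ c)              ≤⟨ minArc-lipschitz n (m≤n+m _ 2) ≤-refl ⟩
  suc (minArc n (suc (toℕ c)))  ≡⟨ cong suc (cycDist-from-last (toℕ c) b+1≡n (toℕ<n c)) ⟨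
  suc (cycDist n (toℕ b) (toℕ c)) ∎
  where open ≤-Reasoning
cycDist-lipschitz n {a} {b} c (inj₂ (inj₂ (b≡0 , a+1≡n))) = begin
  cycDist n (toℕ a) (toℕ c)     ≡⟨ cycDist-from-last (toℕ c) a+1≡n (toℕ<n c) ⟩
  minArc n (suc (toℕ c))        ≤⟨ minArc-lipschitz n ≤-refl (m≤n+m _ 2) ⟩
  suc (minArc n (toℕ c))        ≡⟨ cong (λ i → suc (minArc n ∣ i - toℕ c ∣)) b≡0 ⟨
  suc (cycDist n (toℕ b) (toℕ c)) ∎
  where open ≤-Reasoning

module _ {H n : ℕ} (H+H≤n : H + H ≤ n) (n≤1+H+H : n ≤ suc (H + H)) where

  minArc-≤half : ∀ {d} → d ≤ H → minArc n d ≡ d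
  minArc-≤half {d} d≤H = m≤n⇒m⊓n≡m (m+n≤o⇒m≤o∸n d (≤-trans (+-mono-≤ d≤H d≤H) H+H≤n))

  minArc->half : ∀ {d} → H < d → minArc n d ≡ n ∸ d
  minArc->half {d} H<d = m≥n⇒m⊓n≡n (m≤n+o⇒m∸n≤o n d (≤-trans n≤1+H+H (+-mono-≤ H<d (<⇒≤ H<d))))

  between-direct : ∀ {t c a} → t ≤ c → c ≤ a → a ≤ H + t → Between n t c a
  between-direct {t} {c} {a} t≤c c≤a a≤H+t = begin
    cycDist n t c + cycDist n c a ≤⟨ +-mono-≤ (m⊓n≤m ∣ t - c ∣ _) (m⊓n≤m ∣ c - a ∣ _) ⟩
    ∣ t - c ∣ + ∣ c - a ∣         ≡⟨ cong₂ _+_ (m≤n⇒∣m-n∣≡n∸m t≤c) (m≤n⇒∣m-n∣≡n∸m c≤a) ⟩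
    (c ∸ t) + (a ∸ c)             ≡⟨ ∸-telescope t≤c c≤a ⟩
    a ∸ t                         ≡⟨ minArc-≤half (m≤n+o⇒m∸n≤o a t (subst (a ≤_) (+-comm H t) a≤H+t)) ⟨
    minArc n (a ∸ t)              ≡⟨ cong (minArc n) (m≤n⇒∣m-n∣≡n∸m (≤-trans t≤c c≤a)) ⟨
    cycDist n t a                 ∎
    where open ≤-Reasoning

  between-wrapping : ∀ {t c a} → t ≤ a → a ≤ c → c ≤ n → H + t < a → Between n t c a
  between-wrapping {t} {c} {a} t≤a a≤c c≤n H+t<a = begin
    cycDist n t c + cycDist n c a   ≤⟨ +-mono-≤ (m⊓n≤n ∣ t - c ∣ _) (m⊓n≤m ∣ c - a ∣ _) ⟩
    n ∸ ∣ t - c ∣ + ∣ c - a ∣       ≡⟨ cong₂ (λ d e → n ∸ d + e) (m≤n⇒∣m-n∣≡n∸m (≤-trans t≤a a≤c)) (m≤n⇒∣n-m∣≡n∸m a≤c) ⟩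
    n ∸ (c ∸ t) + (c ∸ a)           ≡⟨ cong (λ d → n ∸ d + (c ∸ a)) (∸-telescope t≤a a≤c) ⟨
    n ∸ ((a ∸ t) + (c ∸ a)) + (c ∸ a) ≡⟨ cong (_+ (c ∸ a)) (∸-+-assoc n (a ∸ t) (c ∸ a)) ⟨
    n ∸ (a ∸ t) ∸ (c ∸ a) + (c ∸ a) ≡⟨ m∸n+n≡m c∸a≤n∸[a∸t] ⟩
    n ∸ (a ∸ t)                     ≡⟨ minArc->half (m+n≤o⇒m≤o∸n (suc H) H+t<a) ⟨
    minArc n (a ∸ t)                ≡⟨ cong (minArc n) (m≤n⇒∣m-n∣≡n∸m t≤a) ⟨
    cycDist n t a                   ∎
    where
    open ≤-Reasoning
    c∸a≤n∸[a∸t] : c ∸ a ≤ n ∸ (a ∸ t)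
    c∸a≤n∸[a∸t] = m+n≤o⇒m≤o∸n (c ∸ a)
      (≤-trans (≤-reflexive (trans (+-comm (c ∸ a) _) (∸-telescope t≤a a≤c))) (≤-trans (m∸n≤m c t) c≤n))

module _ {n′ : ℕ} where
  private
    n : ℕ
    n = suc n′

  onCycle : ∀ {x y : Fin n} → Walk (AdjP n) x y → Walk (AdjC n) x y
  onCycle = mapWalk (λ x → x) inj₁

  wrapArc : (x z : Fin n) → Walk (AdjC n) x z
  wrapArc x z = onCycle (straight x fzero) ++
                (inj₂ (inj₁ (refl , cong suc (toℕ-fromℕ n′))) ∷ onCycle (straight (fromℕ n′) z))

  len-wrapArc : ∀ x z → toℕ x ≤ toℕ z → len (AdjC n) (wrapArc x z) ≡ n ∸ (toℕ z ∸ toℕ x)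
  len-wrapArc x z x≤z = begin
    len (AdjC n) (wrapArc x z)
      ≡⟨ len-++ (onCycle (straight x fzero)) _ ⟩
    len (AdjC n) (onCycle (straight x fzero)) + suc (len (AdjC n) (onCycle (straight (fromℕ n′) z)))
      ≡⟨ cong₂ (λ i j → i + suc j) (trans (len-mapWalk _ _ (straight x fzero)) (len-straight x fzero))
                                   (trans (len-mapWalk _ _ (straight (fromℕ n′) z)) (len-straight (fromℕ n′) z)) ⟩
    ∣ toℕ x - 0 ∣ + suc ∣ toℕ (fromℕ n′) - toℕ z ∣
      ≡⟨ cong₂ (λ i j → i + suc ∣ j - toℕ z ∣) (∣-∣-identityʳ (toℕ x)) (toℕ-fromℕ n′) ⟩
    toℕ x + suc ∣ n′ - toℕ z ∣
      ≡⟨ cong (λ j → toℕ x + suc j) (m≤n⇒∣n-m∣≡n∸m z≤n′) ⟩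
    toℕ x + suc (n′ ∸ toℕ z)
      ≡⟨ cong (toℕ x +_) (+-∸-assoc 1 z≤n′) ⟨
    toℕ x + (n ∸ toℕ z)
      ≡⟨ m+[o∸n]≡o∸[n∸m] x≤z (<⇒≤ (toℕ<n z)) ⟩
    n ∸ (toℕ z ∸ toℕ x) ∎
    where
    open ≡-Reasoning
    z≤n′ : toℕ z ≤ n′
    z≤n′ = s≤s⁻¹ (toℕ<n z)

  arc : (x z : Fin n) → Walk (AdjC n) x z
  arc x z with ∣ toℕ x - toℕ z ∣ ≤? n ∸ ∣ toℕ x - toℕ z ∣ | toℕ x ≤? toℕ z
  ... | yes _ | _     = onCycle (straight x z)
  ... | no  _ | yes _ = wrapArc x z
  ... | no  _ | no  _ = reverse AdjC-sym (wrapArc z x)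

  len-arc : ∀ x z → len (AdjC n) (arc x z) ≤ cycDist n (toℕ x) (toℕ z)
  len-arc x z with ∣ toℕ x - toℕ z ∣ ≤? n ∸ ∣ toℕ x - toℕ z ∣ | toℕ x ≤? toℕ z
  ... | yes short | _ = ≤-reflexive (begin
    len (AdjC n) (onCycle (straight x z)) ≡⟨ len-mapWalk _ _ (straight x z) ⟩
    len (AdjP n) (straight x z)           ≡⟨ len-straight x z ⟩
    ∣ toℕ x - toℕ z ∣                     ≡⟨ m≤n⇒m⊓n≡m short ⟨
    cycDist n (toℕ x) (toℕ z)             ∎)
    where open ≡-Reasoning
  ... | no long | yes x≤z = ≤-reflexive (begin
    len (AdjC n) (wrapArc x z) ≡⟨ len-wrapArc x z x≤z ⟩
    n ∸ (toℕ z ∸ toℕ x)        ≡⟨ cong (n ∸_) (m≤n⇒∣m-n∣≡n∸m x≤z) ⟨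
    n ∸ ∣ toℕ x - toℕ z ∣      ≡⟨ minArc-long n long ⟨
    cycDist n (toℕ x) (toℕ z)  ∎)
    where open ≡-Reasoning
  ... | no long | no x≰z = ≤-reflexive (begin
    len (AdjC n) (reverse AdjC-sym (wrapArc z x)) ≡⟨ len-reverse AdjC-sym (wrapArc z x) ⟩
    len (AdjC n) (wrapArc z x)                    ≡⟨ len-wrapArc z x z≤x ⟩
    n ∸ (toℕ x ∸ toℕ z)                           ≡⟨ cong (n ∸_) (m≤n⇒∣n-m∣≡n∸m z≤x) ⟨
    n ∸ ∣ toℕ x - toℕ z ∣                         ≡⟨ minArc-long n long ⟨
    cycDist n (toℕ x) (toℕ z)                     ∎)
    where
    open ≡-Reasoning
    z≤x : toℕ z ≤ toℕ x
    z≤x = <⇒≤ (≰⇒> x≰z)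

-- Shortest paths in P_r □ C_n through a column

module _ {r n′ : ℕ} where
  private
    n : ℕ
    n = suc n′

  gridDist : Fin r × Fin n → Fin r × Fin n → ℕ
  gridDist = productDist (λ a b → ∣ toℕ a - toℕ b ∣) (λ x y → cycDist n (toℕ x) (toℕ y))

  gridDist-refl : ∀ v → gridDist v v ≡ 0
  gridDist-refl (ℓ , x) = cong₂ (λ i j → i + minArc n j) (∣n-n∣≡0 (toℕ ℓ)) (∣n-n∣≡0 (toℕ x))

  gridDist-lipschitz : Lipschitz (PC r n) gridDist
  gridDist-lipschitz = Box-lipschitz {EA = AdjP r} {EB = AdjC n} AdjP-lipschitz (cycDist-lipschitz n)

  inRow : ∀ ℓ {x y} → Walk (AdjC n) x y → Walk (PC r n) (ℓ , x) (ℓ , y)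
  inRow ℓ = mapWalk (ℓ ,_) (λ e → inj₁ (refl , e))

  inColumn : ∀ z {ℓ ℓ′} → Walk (AdjP r) ℓ ℓ′ → Walk (PC r n) (ℓ , z) (ℓ′ , z)
  inColumn z = mapWalk (_, z) (λ e → inj₂ (refl , e))

  route : (ℓ₁ ℓ₂ : Fin r) (x z y : Fin n) → Walk (PC r n) (ℓ₁ , x) (ℓ₂ , y)
  route ℓ₁ ℓ₂ x z y = inRow ℓ₁ (arc x z) ++ (inColumn z (straight ℓ₁ ℓ₂) ++ inRow ℓ₂ (arc z y))

  len-route : ∀ ℓ₁ ℓ₂ x z y → len (PC r n) (route ℓ₁ ℓ₂ x z y) ≤
              ∣ toℕ ℓ₁ - toℕ ℓ₂ ∣ + (cycDist n (toℕ x) (toℕ z) + cycDist n (toℕ z) (toℕ y))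
  len-route ℓ₁ ℓ₂ x z y = begin
    len (PC r n) (route ℓ₁ ℓ₂ x z y)
      ≡⟨ len-++ (inRow ℓ₁ (arc x z)) _ ⟩
    len (PC r n) (inRow ℓ₁ (arc x z)) + len (PC r n) (inColumn z (straight ℓ₁ ℓ₂) ++ inRow ℓ₂ (arc z y))
      ≡⟨ cong (len (PC r n) (inRow ℓ₁ (arc x z)) +_) (len-++ (inColumn z (straight ℓ₁ ℓ₂)) _) ⟩
    len (PC r n) (inRow ℓ₁ (arc x z)) + (len (PC r n) (inColumn z (straight ℓ₁ ℓ₂)) + len (PC r n) (inRow ℓ₂ (arc z y)))
      ≡⟨ cong₂ (λ i j → i + (j + len (PC r n) (inRow ℓ₂ (arc z y))))
               (len-mapWalk _ _ (arc x z)) (trans (len-mapWalk _ _ (straight ℓ₁ ℓ₂)) (len-straight ℓ₁ ℓ₂)) ⟩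
    len (AdjC n) (arc x z) + (∣ toℕ ℓ₁ - toℕ ℓ₂ ∣ + len (PC r n) (inRow ℓ₂ (arc z y)))
      ≤⟨ +-mono-≤ (len-arc x z) (+-monoʳ-≤ ∣ toℕ ℓ₁ - toℕ ℓ₂ ∣ (≤-trans (≤-reflexive (len-mapWalk _ _ (arc z y))) (len-arc z y))) ⟩
    dxz + (∣ toℕ ℓ₁ - toℕ ℓ₂ ∣ + dzy)
      ≡⟨ +-assoc dxz _ dzy ⟨
    dxz + ∣ toℕ ℓ₁ - toℕ ℓ₂ ∣ + dzy
      ≡⟨ cong (_+ dzy) (+-comm dxz _) ⟩
    ∣ toℕ ℓ₁ - toℕ ℓ₂ ∣ + dxz + dzy
      ≡⟨ +-assoc ∣ toℕ ℓ₁ - toℕ ℓ₂ ∣ dxz dzy ⟩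
    ∣ toℕ ℓ₁ - toℕ ℓ₂ ∣ + (dxz + dzy) ∎
    where
    open ≤-Reasoning
    dxz dzy : ℕ
    dxz = cycDist n (toℕ x) (toℕ z)
    dzy = cycDist n (toℕ z) (toℕ y)

  route-geodesic : ∀ ℓ₁ ℓ₂ x z y → Between n (toℕ x) (toℕ z) (toℕ y) →
                   IsGeodesic (PC r n) (route ℓ₁ ℓ₂ x z y)
  route-geodesic ℓ₁ ℓ₂ x z y between =
    len≤lipschitz⇒geodesic gridDist-refl gridDist-lipschitz
      (route ℓ₁ ℓ₂ x z y) (≤-trans (len-route ℓ₁ ℓ₂ x z y) (+-monoʳ-≤ ∣ toℕ ℓ₁ - toℕ ℓ₂ ∣ between))

  onWalk-route : ∀ ℓ₁ ℓ₂ x z y {ℓ} → toℕ ℓ₁ ≤ toℕ ℓ → toℕ ℓ ≤ toℕ ℓ₂ →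
                 OnWalk (PC r n) (ℓ , z) (route ℓ₁ ℓ₂ x z y)
  onWalk-route ℓ₁ ℓ₂ x z y ℓ₁≤ℓ ℓ≤ℓ₂ =
    onWalk-++ʳ (inRow ℓ₁ (arc x z)) (onWalk-++ˡ (inColumn z (straight ℓ₁ ℓ₂))
      (onWalk-mapWalk _ _ (onWalk-straight ℓ₁ ℓ₂ ℓ₁≤ℓ ℓ≤ℓ₂)))

  -- falls back to the column of x, which lies between x and y for every pair
  throughColumn : (x y : Fin n) → ℕ → Fin n
  throughColumn x y c with c <? n
  ... | no _ = x
  ... | yes c<n with cycDist n (toℕ x) c + cycDist n c (toℕ y) ≤? cycDist n (toℕ x) (toℕ y)
  ...   | yes _ = fromℕ< c<n
  ...   | no  _ = x

  throughColumn-between : ∀ x y c → Between n (toℕ x) (toℕ (throughColumn x y c)) (toℕ y)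
  throughColumn-between x y c with c <? n
  ... | no _ = ≤-reflexive (cong (λ i → minArc n i + cycDist n (toℕ x) (toℕ y)) (∣n-n∣≡0 (toℕ x)))
  ... | yes c<n with cycDist n (toℕ x) c + cycDist n c (toℕ y) ≤? cycDist n (toℕ x) (toℕ y)
  ...   | yes between = subst (λ i → Between n (toℕ x) i (toℕ y)) (sym (toℕ-fromℕ< c<n)) between
  ...   | no  _       = ≤-reflexive (cong (λ i → minArc n i + cycDist n (toℕ x) (toℕ y)) (∣n-n∣≡0 (toℕ x)))

  throughColumn-≡ : ∀ x y z → Between n (toℕ x) (toℕ z) (toℕ y) → throughColumn x y (toℕ z) ≡ z
  throughColumn-≡ x y z between with toℕ z <? n
  ... | no z≮n = ⊥-elim (z≮n (toℕ<n z))
  ... | yes z<n with cycDist n (toℕ x) (toℕ z) + cycDist n (toℕ z) (toℕ y) ≤? cycDist n (toℕ x) (toℕ y)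
  ...   | yes _      = fromℕ<-toℕ z z<n
  ...   | no  ¬between = ⊥-elim (¬between between)

  geodesicThrough : (u v : Fin r × Fin n) → ℕ → Walk (PC r n) u v
  geodesicThrough (ℓ₁ , x) (ℓ₂ , y) c = route ℓ₁ ℓ₂ x (throughColumn x y c) y

  geodesicThrough-isGeodesic : ∀ u v c → IsGeodesic (PC r n) (geodesicThrough u v c)
  geodesicThrough-isGeodesic (ℓ₁ , x) (ℓ₂ , y) c =
    route-geodesic ℓ₁ ℓ₂ x _ y (throughColumn-between x y c)

  onWalk-geodesicThrough : ∀ {ℓ₁ ℓ₂ ℓ x y} z → Between n (toℕ x) (toℕ z) (toℕ y) →
                           toℕ ℓ₁ ≤ toℕ ℓ → toℕ ℓ ≤ toℕ ℓ₂ →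
                           OnWalk (PC r n) (ℓ , z) (geodesicThrough (ℓ₁ , x) (ℓ₂ , y) (toℕ z))
  onWalk-geodesicThrough {ℓ₁} {ℓ₂} {ℓ} {x} {y} z between ℓ₁≤ℓ ℓ≤ℓ₂ =
    subst (λ z′ → OnWalk (PC r n) (ℓ , z) (route ℓ₁ ℓ₂ x z′ y)) (sym (throughColumn-≡ x y z between))
      (onWalk-route ℓ₁ ℓ₂ x z y ℓ₁≤ℓ ℓ≤ℓ₂)

-- Placing the top vertices

window : (f : ℕ → ℕ) → f 0 ≡ 0 → (∀ a → f a < f (suc a)) → (∀ a → f (suc a) ≤ 2 + f a) →
         ∀ e → ∃[ a ] e ≤ suc (f a) × f a ≤ e
window f f0≡0 f-inc f-step zero = 0 , z≤n , ≤-reflexive f0≡0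
window f f0≡0 f-inc f-step (suc e) with window f f0≡0 f-inc f-step e
... | a , e≤1+fa , fa≤e with m≤n⇒m<n∨m≡n fa≤e
...   | inj₂ refl = a , ≤-refl , n≤1+n (f a)
...   | inj₁ fa<e = suc a , s≤s (≤-trans e≤1+fa (f-inc a)) , ≤-trans (f-step a) (s≤s fa<e)

module Blocks (n H q : ℕ) (H+H≤n : H + H ≤ n) (n≤1+H+H : n ≤ suc (H + H))
              (q+H≤n : q + H ≤ n) (2≤q : 2 ≤ q) where

  instance
    q-nonZero : NonZero q
    q-nonZero = >-nonZero (≤-trans (s≤s z≤n) 2≤q)

  q≤1+H : q ≤ suc H
  q≤1+H = +-cancelʳ-≤ H q (suc H) (≤-trans q+H≤n n≤1+H+H)

  shift : ℕ → ℕ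
  shift a = q ⊓ (a ∸ H)

  reach : ℕ → ℕ
  reach a = a + shift a

  shift-mono : ∀ {a b} → a ≤ b → shift a ≤ shift b
  shift-mono a≤b = ⊓-monoʳ-≤ q (∸-monoˡ-≤ H a≤b)

  shift<q⇒shift≡a∸H : ∀ a → shift a < q → shift a ≡ a ∸ H
  shift<q⇒shift≡a∸H a shift<q with q ≤? a ∸ H
  ... | yes q≤a∸H = ⊥-elim (<-irrefl (m≤n⇒m⊓n≡m q≤a∸H) shift<q)
  ... | no  q≰a∸H = m≥n⇒m⊓n≡n (<⇒≤ (≰⇒> q≰a∸H))

  reach-mono : ∀ {a b} → a ≤ b → reach a ≤ reach b
  reach-mono a≤b = +-mono-≤ a≤b (shift-mono a≤b)

  reach-zero : reach 0 ≡ 0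
  reach-zero = trans (cong (q ⊓_) (0∸n≡0 H)) (⊓-zeroʳ q)

  reach-inc : ∀ a → reach a < reach (suc a)
  reach-inc a = s≤s (+-monoʳ-≤ a (shift-mono (n≤1+n a)))

  reach-step : ∀ a → reach (suc a) ≤ 2 + reach a
  reach-step a = s≤s (≤-trans (+-monoʳ-≤ a shift-step) (≤-reflexive (+-suc a (shift a))))
    where
    shift-step : shift (suc a) ≤ suc (shift a)
    shift-step = ⊓-mono-≤ (n≤1+n q) (suc[m]∸n≤suc[m∸n] a H)

  reach-n : reach n ≡ n + q
  reach-n = cong (n +_) (m≤n⇒m⊓n≡m (m+n≤o⇒m≤o∸n q q+H≤n))

  anchorWindow : ∀ u → ∃[ a ] u * q + q ≤ suc (reach a) × reach a ≤ u * q + q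
  anchorWindow u = window reach reach-zero reach-inc reach-step (u * q + q)

  anchor : ℕ → ℕ
  anchor u = proj₁ (anchorWindow u)

  blockEnd≤1+reach : ∀ u → u * q + q ≤ suc (reach (anchor u))
  blockEnd≤1+reach u = proj₁ (proj₂ (anchorWindow u))

  reach≤blockEnd : ∀ u → reach (anchor u) ≤ u * q + q
  reach≤blockEnd u = proj₂ (proj₂ (anchorWindow u))

  shift≤blockStart : ∀ u → shift (anchor u) ≤ u * q
  shift≤blockStart u with anchor u ≤? H
  ... | yes a≤H = ≤-trans (m⊓n≤n q _) (≤-trans (≤-reflexive (m≤n⇒m∸n≡0 a≤H)) z≤n)
  ... | no  a≰H = +-cancelʳ-≤ q (shift (anchor u)) (u * q) (begin
    shift (anchor u) + q            ≤⟨ +-monoʳ-≤ (shift (anchor u)) (≤-trans q≤1+H (≰⇒> a≰H)) ⟩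
    shift (anchor u) + anchor u     ≡⟨ +-comm (shift (anchor u)) (anchor u) ⟩
    reach (anchor u)                ≤⟨ reach≤blockEnd u ⟩
    u * q + q                       ∎)
    where open ≤-Reasoning

  anchor<n : ∀ u → u * q < n → anchor u < n
  anchor<n u uq<n with anchor u <? n
  ... | yes a<n = a<n
  ... | no  a≮n = ⊥-elim (<-irrefl refl (begin-strict
    n + q            ≡⟨ reach-n ⟨
    reach n          ≤⟨ reach-mono (≮⇒≥ a≮n) ⟩
    reach (anchor u) ≤⟨ reach≤blockEnd u ⟩
    u * q + q        <⟨ +-monoˡ-< q uq<n ⟩
    n + q            ∎))
    where open ≤-Reasoning

  anchor-<⇒≢ : ∀ {u v} → u < v → anchor u ≢ anchor v
  anchor-<⇒≢ {u} {v} u<v au≡av = 1+n≰n (begin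
    2 + (u * q + q)          ≡⟨ +-comm 2 (u * q + q) ⟩
    u * q + q + 2            ≤⟨ +-monoʳ-≤ (u * q + q) 2≤q ⟩
    u * q + q + q            ≡⟨ cong (_+ q) (+-comm (u * q) q) ⟩
    suc u * q + q            ≤⟨ +-monoˡ-≤ q (*-monoˡ-≤ q u<v) ⟩
    v * q + q                ≤⟨ blockEnd≤1+reach v ⟩
    suc (reach (anchor v))   ≡⟨ cong (λ a → suc (reach a)) au≡av ⟨
    suc (reach (anchor u))   ≤⟨ s≤s (reach≤blockEnd u) ⟩
    suc (u * q + q)          ∎)
    where open ≤-Reasoning

  anchor-injective : ∀ {u v} → anchor u ≡ anchor v → u ≡ v
  anchor-injective {u} {v} au≡av with <-cmp u v
  ... | tri< u<v _ _ = ⊥-elim (anchor-<⇒≢ u<v au≡av)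
  ... | tri≈ _ u≡v _ = u≡v
  ... | tri> _ _ v<u = ⊥-elim (anchor-<⇒≢ v<u (sym au≡av))

  -- column m + uq is served by bottom vertex (m + s) mod q, s the shift of the anchor of block u
  partner : ℕ → ℕ → ℕ
  partner u m = (m + shift (anchor u)) % q

  column : ℕ → ℕ → ℕ
  column u t = (t + (q ∸ shift (anchor u))) % q + u * q

  column-partner : ∀ u {m} → m < q → column u (partner u m) ≡ m + u * q
  column-partner u m<q = cong (_+ u * q) ([[m+s]%q+[q∸s]]%q≡m q m<q (m⊓n≤m q _))

  block-between-direct : ∀ u {m} → m + shift (anchor u) < q →
                      Between n (m + shift (anchor u)) (m + u * q) (anchor u)
  block-between-direct u {m} m+s<q =
    between-direct {H} {n} H+H≤n n≤1+H+H (+-monoʳ-≤ m (shift≤blockStart u)) c≤a a≤H+t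
    where
    open ≤-Reasoning
    a s : ℕ
    a = anchor u
    s = shift a
    c≤a : m + u * q ≤ a
    c≤a = +-cancelʳ-≤ s (m + u * q) a (s≤s⁻¹ (begin
      suc (m + u * q + s)    ≡⟨ cong suc (m+n+o≡n+[m+o] m (u * q) s) ⟩
      suc (u * q + (m + s))  ≡⟨ +-suc (u * q) (m + s) ⟨
      u * q + suc (m + s)    ≤⟨ +-monoʳ-≤ (u * q) m+s<q ⟩
      u * q + q              ≤⟨ blockEnd≤1+reach u ⟩
      suc (a + s)            ∎))
    a≤H+t : a ≤ H + (m + s)
    a≤H+t = begin
      a            ≤⟨ m≤n+m∸n a H ⟩
      H + (a ∸ H)  ≡⟨ cong (H +_) (shift<q⇒shift≡a∸H a (≤-<-trans (m≤n+m s m) m+s<q)) ⟨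
      H + s        ≤⟨ +-monoʳ-≤ H (m≤n+m s m) ⟩
      H + (m + s)  ∎

  block-between-wrapping : ∀ u {m} → m < q → q ≤ m + shift (anchor u) → m + u * q < n →
                     Between n (m + shift (anchor u) ∸ q) (m + u * q) (anchor u)
  block-between-wrapping u {m} m<q q≤m+s c<n =
    between-wrapping {H} {n} H+H≤n n≤1+H+H (≤-trans (<⇒≤ t<a∸H) (m∸n≤m a H)) a≤c (<⇒≤ c<n) H+t<a
    where
    open ≤-Reasoning
    a s t : ℕ
    a = anchor u
    s = shift a
    t = m + s ∸ q
    t<a∸H : t < a ∸ H
    t<a∸H = <-≤-trans (+-cancelʳ-< q t s (begin-strict
      t + q   ≡⟨ m∸n+n≡m q≤m+s ⟩
      m + s   <⟨ +-monoˡ-< s m<q ⟩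
      q + s   ≡⟨ +-comm q s ⟩
      s + q   ∎)) (m⊓n≤n q (a ∸ H))
    H<a : H < a
    H<a = m∸n≢0⇒n<m (λ a∸H≡0 → n≮0 (subst (t <_) a∸H≡0 t<a∸H))
    a≤c : a ≤ m + u * q
    a≤c = +-cancelʳ-≤ s a (m + u * q) (begin
      a + s            ≤⟨ reach≤blockEnd u ⟩
      u * q + q        ≤⟨ +-monoʳ-≤ (u * q) q≤m+s ⟩
      u * q + (m + s)  ≡⟨ m+n+o≡n+[m+o] m (u * q) s ⟨
      m + u * q + s    ∎)
    H+t<a : H + t < a
    H+t<a = begin-strict
      H + t        <⟨ +-monoʳ-< H t<a∸H ⟩
      H + (a ∸ H)  ≡⟨ m+[n∸m]≡n (<⇒≤ H<a) ⟩
      a            ∎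

  partner-between : ∀ u {m} → m < q → m + u * q < n → Between n (partner u m) (m + u * q) (anchor u)
  partner-between u {m} m<q c<n with m + shift (anchor u) <? q
  ... | yes m+s<q = subst (λ t → Between n t (m + u * q) (anchor u)) (sym (m<n⇒m%n≡m m+s<q))
                      (block-between-direct u m+s<q)
  ... | no  m+s≮q = subst (λ t → Between n t (m + u * q) (anchor u)) (sym partner≡m+s∸q)
                      (block-between-wrapping u m<q q≤m+s c<n)
    where
    s : ℕ
    s = shift (anchor u)
    q≤m+s : q ≤ m + s
    q≤m+s = ≮⇒≥ m+s≮q
    m+s∸q<q : m + s ∸ q < q
    m+s∸q<q = +-cancelʳ-< q _ q
      (subst (_< q + q) (sym (m∸n+n≡m q≤m+s)) (+-mono-<-≤ m<q (m⊓n≤m q _)))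
    partner≡m+s∸q : (m + s) % q ≡ m + s ∸ q
    partner≡m+s∸q = trans (cong (_% q) (sym (m∸n+n≡m q≤m+s)))
                          (trans ([m+n]%n≡m%n (m + s ∸ q) q) (m<n⇒m%n≡m m+s∸q<q))

-- The strong geodetic set

module StrongGeodeticSet (n′ r′ q p : ℕ) (2≤q : 2 ≤ q) (q+H≤n : q + ⌊ suc n′ /2⌋ ≤ suc n′)
                         (n≤pq : suc n′ ≤ p * q) (1≤r′ : 1 ≤ r′) where
  private
    n r H : ℕ
    n = suc n′
    r = suc r′
    H = ⌊ n /2⌋

  open Blocks n H q (⌊n/2⌋+⌊n/2⌋≤n n) (n≤1+⌊n/2⌋+⌊n/2⌋ n) q+H≤n 2≤q

  blocks : ℕ
  blocks = suc (n′ / q)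

  blocks≤p : blocks ≤ p
  blocks≤p = m<n*o⇒m/o<n n≤pq

  blockStart<n : ∀ {u} → u < blocks → u * q < n
  blockStart<n u<blocks = s≤s (≤-trans (*-monoˡ-≤ q (s≤s⁻¹ u<blocks)) (m/n*n≤m n′ q))

  vertex : Fin q ⊎ Fin blocks → Fin r × Fin n
  vertex (inj₁ t) = fzero , fromℕ< (<-≤-trans (toℕ<n t) (≤-trans (m≤m+n q H) q+H≤n))
  vertex (inj₂ u) = fromℕ r′ , fromℕ< (anchor<n (toℕ u) (blockStart<n (toℕ<n u)))

  toℕ-bottom : ∀ t → toℕ (proj₂ (vertex (inj₁ t))) ≡ toℕ t
  toℕ-bottom t = toℕ-fromℕ< _

  toℕ-top : ∀ u → toℕ (proj₂ (vertex (inj₂ u))) ≡ anchor (toℕ u)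
  toℕ-top u = toℕ-fromℕ< _

  vertex-injective : ∀ {i j} → vertex i ≡ vertex j → i ≡ j
  vertex-injective {inj₁ t} {inj₁ t′} eq = cong inj₁ (toℕ-injective (begin
    toℕ t                          ≡⟨ toℕ-bottom t ⟨
    toℕ (proj₂ (vertex (inj₁ t)))  ≡⟨ cong (λ v → toℕ (proj₂ v)) eq ⟩
    toℕ (proj₂ (vertex (inj₁ t′))) ≡⟨ toℕ-bottom t′ ⟩
    toℕ t′                         ∎))
    where open ≡-Reasoning
  vertex-injective {inj₂ u} {inj₂ u′} eq = cong inj₂ (toℕ-injective (anchor-injective (begin
    anchor (toℕ u)                 ≡⟨ toℕ-top u ⟨
    toℕ (proj₂ (vertex (inj₂ u)))  ≡⟨ cong (λ v → toℕ (proj₂ v)) eq ⟩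
    toℕ (proj₂ (vertex (inj₂ u′))) ≡⟨ toℕ-top u′ ⟩
    anchor (toℕ u′)                ∎)))
    where open ≡-Reasoning
  vertex-injective {inj₁ _} {inj₂ _} eq = ⊥-elim (rows-differ (cong (λ v → toℕ (proj₁ v)) eq))
    where rows-differ : 0 ≢ toℕ (fromℕ r′)
          rows-differ 0≡r′ = <-irrefl (trans 0≡r′ (toℕ-fromℕ r′)) 1≤r′
  vertex-injective {inj₂ _} {inj₁ _} eq = ⊥-elim (rows-differ (cong (λ v → toℕ (proj₁ v)) eq))
    where rows-differ : toℕ (fromℕ r′) ≢ 0
          rows-differ r′≡0 = <-irrefl (sym (trans (sym (toℕ-fromℕ r′)) r′≡0)) 1≤r′

  S : Fin (q + blocks) → Fin r × Fin n
  S i = vertex (splitAt q i)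

  S-injective : Injective _≡_ _≡_ S
  S-injective {i} {j} eq = begin
    i                             ≡⟨ join-splitAt q blocks i ⟨
    join q blocks (splitAt q i)   ≡⟨ cong (join q blocks) (vertex-injective eq) ⟩
    join q blocks (splitAt q j)   ≡⟨ join-splitAt q blocks j ⟩
    j                             ∎
    where open ≡-Reasoning

  servedColumn : Fin q ⊎ Fin blocks → Fin q ⊎ Fin blocks → ℕ
  servedColumn (inj₁ t) (inj₂ u) = column (toℕ u) (toℕ t)
  servedColumn _        _        = 0

  geodesic : (i j : Fin (q + blocks)) → toℕ i < toℕ j → Walk (PC r n) (S i) (S j)
  geodesic i j _ = geodesicThrough (S i) (S j) (servedColumn (splitAt q i) (splitAt q j))

  onWalk-geodesic : ∀ t u {ℓ} z → Between n (toℕ t) (toℕ z) (anchor (toℕ u)) →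
                    column (toℕ u) (toℕ t) ≡ toℕ z → (h : toℕ (t ↑ˡ blocks) < toℕ (q ↑ʳ u)) →
                    OnWalk (PC r n) (ℓ , z) (geodesic (t ↑ˡ blocks) (q ↑ʳ u) h)
  onWalk-geodesic t u {ℓ} z between served _
    rewrite splitAt-↑ˡ q t blocks | splitAt-↑ʳ q blocks u | served =
    onWalk-geodesicThrough z
      (subst₂ (λ i k → Between n i (toℕ z) k) (sym (toℕ-bottom t)) (sym (toℕ-top u)) between)
      z≤n (subst (toℕ ℓ ≤_) (sym (toℕ-fromℕ r′)) (s≤s⁻¹ (toℕ<n ℓ)))

  covered : ∀ v → Σ (Fin (q + blocks)) λ i → Σ (Fin (q + blocks)) λ j → Σ (toℕ i < toℕ j) λ h →
                  OnWalk (PC r n) v (geodesic i j h)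
  covered (ℓ , z) = t ↑ˡ blocks , q ↑ʳ u , t<u ,
                    onWalk-geodesic t u z between served t<u
    where
    c m b : ℕ
    c = toℕ z
    m = c % q
    b = c / q
    m+bq≡c : m + b * q ≡ c
    m+bq≡c = sym (m≡m%n+[m/n]*n c q)
    m<q : m < q
    m<q = m%n<n c q
    b<blocks : b < blocks
    b<blocks = s≤s (/-monoˡ-≤ q (s≤s⁻¹ (toℕ<n z)))
    u : Fin blocks
    u = fromℕ< b<blocks
    t : Fin q
    t = fromℕ< (m%n<n (m + shift (anchor b)) q)
    toℕ-t : toℕ t ≡ partner b m
    toℕ-t = toℕ-fromℕ< _
    toℕ-u : toℕ u ≡ b
    toℕ-u = toℕ-fromℕ< b<blocks
    t<u : toℕ (t ↑ˡ blocks) < toℕ (q ↑ʳ u)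
    t<u = subst₂ _<_ (sym (toℕ-↑ˡ t blocks)) (sym (toℕ-↑ʳ q u)) (<-≤-trans (toℕ<n t) (m≤m+n q (toℕ u)))
    served : column (toℕ u) (toℕ t) ≡ c
    served = begin
      column (toℕ u) (toℕ t)      ≡⟨ cong₂ column toℕ-u toℕ-t ⟩
      column b (partner b m)      ≡⟨ column-partner b m<q ⟩
      m + b * q                   ≡⟨ m+bq≡c ⟩
      c                           ∎
      where open ≡-Reasoning
    between : Between n (toℕ t) c (anchor (toℕ u))
    between = subst₂ (λ i k → Between n i k (anchor (toℕ u))) (sym toℕ-t) m+bq≡c
                (subst (λ k → Between n (partner b m) (m + b * q) (anchor k)) (sym toℕ-u)
                  (partner-between b m<q (subst (_< n) (sym m+bq≡c) (toℕ<n z))))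

  strongGeodetic : SgAtMost (PC r n) (q + p)
  strongGeodetic = q + blocks , S , +-monoʳ-≤ q blocks≤p , S-injective , geodesic ,
                   (λ i j _ → geodesicThrough-isGeodesic (S i) (S j) (servedColumn (splitAt q i) (splitAt q j))) ,
                   covered

k*k≤4*[⌊k/2⌋*⌈k/2⌉]+1 : ∀ k → k * k ≤ 4 * (⌊ k /2⌋ * ⌈ k /2⌉) + 1
k*k≤4*[⌊k/2⌋*⌈k/2⌉]+1 zero          = z≤n
k*k≤4*[⌊k/2⌋*⌈k/2⌉]+1 (suc zero)    = ≤-refl
k*k≤4*[⌊k/2⌋*⌈k/2⌉]+1 (suc (suc k)) = begin
  (2 + k) * (2 + k)                     ≡⟨ square-step k ⟩
  k * k + (4 * k + 4)                   ≤⟨ +-monoˡ-≤ (4 * k + 4) (k*k≤4*[⌊k/2⌋*⌈k/2⌉]+1 k) ⟩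
  4 * (p * q) + 1 + (4 * k + 4)         ≡⟨ cong (λ s → 4 * (p * q) + 1 + (4 * s + 4)) (⌊n/2⌋+⌈n/2⌉≡n k) ⟨
  4 * (p * q) + 1 + (4 * (p + q) + 4)   ≡⟨ product-step p q ⟨
  4 * (suc p * suc q) + 1               ∎
  where
  open ≤-Reasoning
  open +-*-Solver
  p q : ℕ
  p = ⌊ k /2⌋
  q = ⌈ k /2⌉
  square-step : ∀ k → (2 + k) * (2 + k) ≡ k * k + (4 * k + 4)
  square-step = solve 1 (λ k → (con 2 :+ k) :* (con 2 :+ k) := k :* k :+ (con 4 :* k :+ con 4)) refl
  product-step : ∀ p q → 4 * (suc p * suc q) + 1 ≡ 4 * (p * q) + 1 + (4 * (p + q) + 4)
  product-step = solve 2 (λ p q → con 4 :* ((con 1 :+ p) :* (con 1 :+ q)) :+ con 1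
                                  := con 4 :* (p :* q) :+ con 1 :+ (con 4 :* (p :+ q) :+ con 4)) refl

4*m≤4*n+1⇒m≤n : ∀ {m n} → 4 * m ≤ 4 * n + 1 → m ≤ n
4*m≤4*n+1⇒m≤n {m} {n} 4m≤4n+1 with m ≤? n
... | yes m≤n = m≤n
... | no  m≰n = ⊥-elim (<⇒≱ (s≤s (s≤s z≤n)) (+-cancelˡ-≤ (4 * n) 4 1 (begin
  4 * n + 4    ≡⟨ +-comm (4 * n) 4 ⟩
  4 + 4 * n    ≡⟨ *-suc 4 n ⟨
  4 * suc n    ≤⟨ *-monoʳ-≤ 4 (≰⇒> m≰n) ⟩
  4 * m        ≤⟨ 4m≤4n+1 ⟩
  4 * n + 1    ∎)))
  where open ≤-Reasoning

ceil2sqrt-≤⌊/2⌋*⌈/2⌉ : ∀ {n k} → IsCeil2Sqrt n k → n ≤ ⌊ k /2⌋ * ⌈ k /2⌉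
ceil2sqrt-≤⌊/2⌋*⌈/2⌉ {k = k} (4n≤k*k , _) = 4*m≤4*n+1⇒m≤n (≤-trans 4n≤k*k (k*k≤4*[⌊k/2⌋*⌈k/2⌉]+1 k))

ceil2sqrt-≥4 : ∀ {n k} → 3 ≤ n → IsCeil2Sqrt n k → 4 ≤ k
ceil2sqrt-≥4 {n} {k} 3≤n (4n≤k*k , _) with 4 ≤? k
... | yes 4≤k = 4≤k
... | no  4≰k = ⊥-elim (<⇒≱ (begin-strict
  k * k   ≤⟨ *-mono-≤ k≤3 k≤3 ⟩
  9       <⟨ m≤m+n 10 2 ⟩
  12      ≤⟨ *-monoʳ-≤ 4 3≤n ⟩
  4 * n   ∎) 4n≤k*k)
  where
  open ≤-Reasoning
  k≤3 : k ≤ 3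
  k≤3 = s≤s⁻¹ (≰⇒> 4≰k)

-- ⌈2√n⌉ ≤ n fails only for n = 3, where ⌈2√3⌉ = 4 still has half 2 = ⌈3/2⌉
ceil2sqrt-⌈/2⌉ : ∀ {n k} → 3 ≤ n → IsCeil2Sqrt n k → ⌈ k /2⌉ ≤ ⌈ n /2⌉
ceil2sqrt-⌈/2⌉ {n} {k} 3≤n (_ , minimal) with k ≤? n
... | yes k≤n = ⌈n/2⌉-mono k≤n
... | no  k≰n with refl ← ≤-antisym (s≤s⁻¹ (*-cancelʳ-< n n 4 (minimal n (≰⇒> k≰n)))) 3≤n =
  ⌈n/2⌉-mono (≮⇒≥ (λ 4<k → <⇒≱ (minimal 4 4<k) (m≤m+n 12 4)))

lemma3p3 : (n r : ℕ) → 3 ≤ n → n ≤ r → (k : ℕ) → IsCeil2Sqrt n k →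
    SgAtMost (PC r n) k
lemma3p3 (suc n′) (suc r′) 3≤n n≤r k ceil =
  subst (SgAtMost (PC (suc r′) (suc n′))) q+p≡k
    (StrongGeodeticSet.strongGeodetic n′ r′ q p 2≤q q+H≤n (ceil2sqrt-≤⌊/2⌋*⌈/2⌉ ceil) 1≤r′)
  where
  p q : ℕ
  p = ⌊ k /2⌋
  q = ⌈ k /2⌉
  2≤q : 2 ≤ q
  2≤q = ⌈n/2⌉-mono (ceil2sqrt-≥4 3≤n ceil)
  q+H≤n : q + ⌊ suc n′ /2⌋ ≤ suc n′
  q+H≤n = ≤-trans (≤-reflexive (+-comm q _))
            (≤-trans (+-monoʳ-≤ ⌊ suc n′ /2⌋ (ceil2sqrt-⌈/2⌉ 3≤n ceil)) (≤-reflexive (⌊n/2⌋+⌈n/2⌉≡n (suc n′))))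
  1≤r′ : 1 ≤ r′
  1≤r′ = ≤-trans (s≤s z≤n) (s≤s⁻¹ (≤-trans 3≤n n≤r))
  q+p≡k : q + p ≡ k
  q+p≡k = trans (+-comm q p) (⌊n/2⌋+⌈n/2⌉≡n k)
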